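{- Let $k\in\mathbb N$, $m,l\in\mathbb N$, $p_1,\dots,p_m,r_1,\dots,r_l\in E_k$ and $c_1,\dots,c_l\in\{0,1\}$. Then \[\Big\langle \bigvee_{i=1}^m(u_i^{p_i}=v_i^{p_i})\lor\bigvee_{h=1}^l(z_h^{r_h}=c_h)\Big\rangle_{\mathrm{qpp}}=\Big\langle \bigvee_{i=1}^m(u_i^{p_i}=v_i^{p_i})\lor\bigvee_{h=2}^l(z_h^{r_h}=c_h),\ (u_1^{p_1}=v_1^{p_1})\lor(z_1^{r_1}=c_1)\Big\rangle_{\mathrm{qpp}}.\]
   Context: $E_k=\{1,\dots,k\}$; superscripts denote sorts. A $k$-sorted relation on $\{0,1\}$ is a subset of $\{0,1\}^n$ with each variable assigned a sort in $E_k$; a displayed disjunction of equations denotes the relation on its variables (with indicated sorts) it defines. $\sigma_\bot$ is the empty $0$-ary relation, $\sigma^i_=$ equality on sort $i$. For a set $S$ of relations, $\langle S\rangle_{\mathrm{qpp}}$ is the set of relations definable by formulas built from predicates in $S\cup\{\sigma_\bot,\sigma_=^1,\dots,\sigma_=^k\}$ using conjunction, existential and universal quantification only, each variable having one sort and substituted only into positions of that sort. -}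

module Defs where

open import Data.Nat using (ℕ; zero; suc; _+_)
open import Data.Fin using (Fin; zero; suc; _↑ˡ_; _↑ʳ_)
open import Data.Vec using (Vec; []; _∷_; lookup; tabulate; _++_)
open import Data.Bool using (Bool; true; false; _∨_; _∧_; not; _xor_; T)
open import Data.Empty using (⊥)
open import Data.Product using (Σ; _×_)
open import Relation.Binary.PropositionalEquality using (_≡_)
open import Function.Bundles using (_⇔_)

-- A k-sorted relation on {0,1}: arity n, a sort in E_k = Fin k for each
-- position, and the (decidable) set of tuples in {0,1}^n it contains.
record SRel (k : ℕ) : Set where
  field
    arity : ℕ
    sorts : Vec (Fin k) arity
    mem   : Vec Bool arity → Bool
open SRel public

data Fm {k s : ℕ} (S : Vec (SRel k) s) : {n : ℕ} → Vec (Fin k) n → Set where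
  bot  : ∀ {n} {Γ : Vec (Fin k) n} → Fm S Γ
  eq   : ∀ {n} {Γ : Vec (Fin k) n} (i : Fin k) (x y : Fin n) →
         lookup Γ x ≡ i → lookup Γ y ≡ i → Fm S Γ
  atom : ∀ {n} {Γ : Vec (Fin k) n} (j : Fin s)
         (args : Fin (arity (lookup S j)) → Fin n) →
         (∀ a → lookup Γ (args a) ≡ lookup (sorts (lookup S j)) a) → Fm S Γ
  and  : ∀ {n} {Γ : Vec (Fin k) n} → Fm S Γ → Fm S Γ → Fm S Γ
  ex   : ∀ {n} {Γ : Vec (Fin k) n} (i : Fin k) → Fm S (i ∷ Γ) → Fm S Γ
  all  : ∀ {n} {Γ : Vec (Fin k) n} (i : Fin k) → Fm S (i ∷ Γ) → Fm S Γ

⟦_⟧ : ∀ {k s} {S : Vec (SRel k) s} {n} {Γ : Vec (Fin k) n} →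
      Fm S Γ → Vec Bool n → Set
⟦ bot ⟧ t = ⊥
⟦ eq i x y _ _ ⟧ t = lookup t x ≡ lookup t y
⟦_⟧ {S = S} (atom j args _) t = T (mem (lookup S j) (tabulate (λ a → lookup t (args a))))
⟦ and φ ψ ⟧ t = ⟦ φ ⟧ t × ⟦ ψ ⟧ t
⟦ ex i φ ⟧ t = Σ Bool (λ b → ⟦ φ ⟧ (b ∷ t))
⟦ all i φ ⟧ t = (b : Bool) → ⟦ φ ⟧ (b ∷ t)

_∈qpp_ : ∀ {k s} → SRel k → Vec (SRel k) s → Set
R ∈qpp S = Σ (Fm S (sorts R)) (λ φ → (t : Vec Bool (arity R)) → T (mem R t) ⇔ ⟦ φ ⟧ t)

_≡qpp_ : ∀ {k s s'} → Vec (SRel k) s → Vec (SRel k) s' → Set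
S ≡qpp S' = ∀ R → (R ∈qpp S) ⇔ (R ∈qpp S')

anyF : (n : ℕ) → (Fin n → Bool) → Bool
anyF zero f = false
anyF (suc n) f = f zero ∨ anyF n (λ i → f (suc i))

eqB : Bool → Bool → Bool
eqB a b = not (a xor b)

-- The relation  ⋁_{i=1}^m (u_i^{p_i} = v_i^{p_i}) ∨ ⋁_{h=1}^l (z_h^{r_h} = c_h)
-- on variables ordered u_1..u_m, v_1..v_m, z_1..z_l.
disj : ∀ {k m l} → Vec (Fin k) m → Vec (Fin k) l → Vec Bool l → SRel k
disj {k} {m} {l} p r c = record
  { arity = m + m + l
  ; sorts = (p ++ p) ++ r
  ; mem = λ t →
      anyF m (λ i → eqB (lookup t ((i ↑ˡ m) ↑ˡ l))
                        (lookup t ((m ↑ʳ i) ↑ˡ l)))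
      ∨ anyF l (λ h → eqB (lookup t ((m + m) ↑ʳ h)) (lookup c h))
  }

-- Write the relation as (u₁ = v₁ ∨ D) ∨ (z₁ = c₁ ∨ Z), with D and Z the remaining disjuncts.
-- It is primitive positive definable from the two relations on the right through a pivot w:
--   (u₁ = v₁ ∨ D) ∨ (z₁ = c₁ ∨ Z)  ⟺  ∃ w. (w = v₁ ∨ D ∨ Z) ∧ (u₁ = w ∨ z₁ = c₁)
-- (take w = v₁ if z₁ = c₁ and w = u₁ otherwise). Conversely, dropping the disjunct z₁ = c₁ is
-- ∀ z₁ (the instance z₁ = ¬c₁ kills it), and (u₁ = v₁) ∨ (z₁ = c₁) is obtained by quantifying
-- universally over all other variables (the instance uᵢ = ¬vᵢ, z_h = ¬c_h kills D and Z).
-- Definability is transitive, by substituting defining formulas for atoms, so the two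
-- qpp-closures coincide.
module Submission where

open import Defs
open import Data.Nat using (ℕ; zero; suc; _+_)
open import Data.Fin using (Fin; zero; suc; _↑ˡ_; _↑ʳ_; lift)
open import Data.Bool using (Bool; true; false; _∨_; not; T)
open import Data.Bool.Properties using (T-∨; ∨-identityʳ)
open import Data.Sum using (inj₁; inj₂)
import Data.Sum as Sum
open import Data.Product using (Σ; _×_; _,_; proj₁; proj₂)
open import Data.Product.Function.NonDependent.Propositional using (_×-⇔_)
open import Data.Vec using (Vec; []; _∷_; lookup; tabulate; _++_; map; allFin; splitAt; head; tail; replicate)
open import Data.Vec.Properties
  using (lookup∘tabulate; tabulate∘lookup; tabulate-∘; tabulate-cong; lookup-map; map-∘; map-cong; map-++;
         map-lookup-allFin; lookup-++ˡ; lookup-++ʳ)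
open import Function.Base using (_∘_; id)
open import Function.Bundles using (_⇔_; mk⇔; Equivalence)
import Function.Properties.Equivalence as ⇔
open import Function.Related.Propositional using (≡⇒; equivalence; module EquationalReasoning)
open import Relation.Binary.PropositionalEquality
  using (_≡_; refl; sym; trans; cong; cong₂; subst; module ≡-Reasoning)

open Equivalence using (to; from)

private
  variable
    k s n n' j : ℕ
    X : Set

⇔-reflexive : {A B : Set} → A ≡ B → A ⇔ B
⇔-reflexive = ≡⇒ {k = equivalence}

Σ-cong-⇔ : {I : Set} {A B : I → Set} → (∀ i → A i ⇔ B i) → Σ I A ⇔ Σ I B
Σ-cong-⇔ A⇔B = mk⇔ (λ (i , a) → i , to (A⇔B i) a) (λ (i , b) → i , from (A⇔B i) b)

Π-cong-⇔ : {I : Set} {A B : I → Set} → (∀ i → A i ⇔ B i) → ((i : I) → A i) ⇔ ((i : I) → B i)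
Π-cong-⇔ A⇔B = mk⇔ (λ f i → to (A⇔B i) (f i)) (λ g i → from (A⇔B i) (g i))

module Formulas (S : Vec (SRel k) s) where

  SortPreserving : Vec (Fin k) n → Vec (Fin k) n' → (Fin n → Fin n') → Set
  SortPreserving Γ Γ' ρ = ∀ x → lookup Γ' (ρ x) ≡ lookup Γ x

  lift-sortPreserving : {Γ : Vec (Fin k) n} {Γ' : Vec (Fin k) n'} {ρ : Fin n → Fin n'} (i : Fin k) →
                        SortPreserving Γ Γ' ρ → SortPreserving (i ∷ Γ) (i ∷ Γ') (lift 1 ρ)
  lift-sortPreserving i ρ-sorts zero    = refl
  lift-sortPreserving i ρ-sorts (suc x) = ρ-sorts x

  rename : {Γ : Vec (Fin k) n} {Γ' : Vec (Fin k) n'} (ρ : Fin n → Fin n') →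
           SortPreserving Γ Γ' ρ → Fm S Γ → Fm S Γ'
  rename ρ ρ-sorts bot              = bot
  rename ρ ρ-sorts (eq i x y px py) = eq i (ρ x) (ρ y) (trans (ρ-sorts x) px) (trans (ρ-sorts y) py)
  rename ρ ρ-sorts (atom j args pa) = atom j (ρ ∘ args) (λ a → trans (ρ-sorts (args a)) (pa a))
  rename ρ ρ-sorts (and φ ψ)        = and (rename ρ ρ-sorts φ) (rename ρ ρ-sorts ψ)
  rename ρ ρ-sorts (ex i φ)         = ex i (rename (lift 1 ρ) (lift-sortPreserving i ρ-sorts) φ)
  rename ρ ρ-sorts (all i φ)        = all i (rename (lift 1 ρ) (lift-sortPreserving i ρ-sorts) φ)

  ⟦rename⟧ : {Γ : Vec (Fin k) n} (Γ' : Vec (Fin k) n') (ρ : Fin n → Fin n') (ρ-sorts : SortPreserving Γ Γ' ρ)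
             (φ : Fm S Γ) (t : Vec Bool n') →
             ⟦ rename {Γ = Γ} {Γ'} ρ ρ-sorts φ ⟧ t ⇔ ⟦ φ ⟧ (tabulate (lookup t ∘ ρ))
  ⟦rename⟧ Γ' ρ ρ-sorts bot t = ⇔.refl
  ⟦rename⟧ Γ' ρ ρ-sorts (eq i x y _ _) t =
    ⇔-reflexive (sym (cong₂ _≡_ (lookup∘tabulate (lookup t ∘ ρ) x) (lookup∘tabulate (lookup t ∘ ρ) y)))
  ⟦rename⟧ Γ' ρ ρ-sorts (atom j args _) t =
    ⇔-reflexive (cong (T ∘ mem (lookup S j))
                      (tabulate-cong (λ a → sym (lookup∘tabulate (lookup t ∘ ρ) (args a)))))
  ⟦rename⟧ Γ' ρ ρ-sorts (and φ ψ) t = ⟦rename⟧ Γ' ρ ρ-sorts φ t ×-⇔ ⟦rename⟧ Γ' ρ ρ-sorts ψ t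
  ⟦rename⟧ Γ' ρ ρ-sorts (ex i φ) t =
    Σ-cong-⇔ (λ b → ⟦rename⟧ (i ∷ Γ') (lift 1 ρ) (lift-sortPreserving i ρ-sorts) φ (b ∷ t))
  ⟦rename⟧ Γ' ρ ρ-sorts (all i φ) t =
    Π-cong-⇔ (λ b → ⟦rename⟧ (i ∷ Γ') (lift 1 ρ) (lift-sortPreserving i ρ-sorts) φ (b ∷ t))

  atomᵛ : {Γ : Vec (Fin k) n} (j : Fin s) (xs : Vec (Fin n) (arity (lookup S j))) →
          map (lookup Γ) xs ≡ sorts (lookup S j) → Fm S Γ
  atomᵛ {Γ = Γ} j xs xs-sorts =
    atom j (lookup xs) (λ a → trans (sym (lookup-map a (lookup Γ) xs)) (cong (λ Δ → lookup Δ a) xs-sorts))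

  ⟦atomᵛ⟧ : {Γ : Vec (Fin k) n} (j : Fin s) (xs : Vec (Fin n) (arity (lookup S j)))
            (xs-sorts : map (lookup Γ) xs ≡ sorts (lookup S j))
            (t : Vec Bool n) {ys : Vec Bool (arity (lookup S j))} →
            map (lookup t) xs ≡ ys → ⟦ atomᵛ {Γ = Γ} j xs xs-sorts ⟧ t ≡ T (mem (lookup S j) ys)
  ⟦atomᵛ⟧ j xs _ t xs-values = cong (T ∘ mem (lookup S j))
    (trans (tabulate-∘ (lookup t) (lookup xs)) (trans (cong (map (lookup t)) (tabulate∘lookup xs)) xs-values))

  ∀ⁿ : {Γ : Vec (Fin k) n} (Δ : Vec (Fin k) j) → Fm S (Δ ++ Γ) → Fm S Γ
  ∀ⁿ []      φ = φ
  ∀ⁿ (i ∷ Δ) φ = ∀ⁿ Δ (all i φ)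

  ⟦∀ⁿ⟧ : {Γ : Vec (Fin k) n} (Δ : Vec (Fin k) j) (φ : Fm S (Δ ++ Γ)) (t : Vec Bool n) →
         ⟦ ∀ⁿ Δ φ ⟧ t ⇔ ((u : Vec Bool j) → ⟦ φ ⟧ (u ++ t))
  ⟦∀ⁿ⟧ []      φ t = mk⇔ (λ { q [] → q }) (λ q → q [])
  ⟦∀ⁿ⟧ (i ∷ Δ) φ t = ⇔.trans (⟦∀ⁿ⟧ Δ (all i φ) t) (mk⇔ (λ { q (b ∷ u) → q u b }) (λ q u b → q (b ∷ u)))

module _ {S : Vec (SRel k) s} {s' : ℕ} {S' : Vec (SRel k) s'} (definable : ∀ j → lookup S j ∈qpp S') where
  open Formulas S' using (rename; ⟦rename⟧)

  expand : {Γ : Vec (Fin k) n} → Fm S Γ → Fm S' Γ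
  expand bot              = bot
  expand (eq i x y px py) = eq i x y px py
  expand (atom j args pa) = rename args pa (proj₁ (definable j))
  expand (and φ ψ)        = and (expand φ) (expand ψ)
  expand (ex i φ)         = ex i (expand φ)
  expand (all i φ)        = all i (expand φ)

  ⟦expand⟧ : {Γ : Vec (Fin k) n} (φ : Fm S Γ) (t : Vec Bool n) → ⟦ expand φ ⟧ t ⇔ ⟦ φ ⟧ t
  ⟦expand⟧ bot              t = ⇔.refl
  ⟦expand⟧ (eq i x y px py) t = ⇔.refl
  ⟦expand⟧ {Γ = Γ} (atom j args pa) t =
    ⇔.trans (⟦rename⟧ Γ args pa (proj₁ (definable j)) t)
            (⇔.sym (proj₂ (definable j) (tabulate (lookup t ∘ args))))
  ⟦expand⟧ (and φ ψ)        t = ⟦expand⟧ φ t ×-⇔ ⟦expand⟧ ψ t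
  ⟦expand⟧ (ex i φ)         t = Σ-cong-⇔ (λ b → ⟦expand⟧ φ (b ∷ t))
  ⟦expand⟧ (all i φ)        t = Π-cong-⇔ (λ b → ⟦expand⟧ φ (b ∷ t))

  ∈qpp-trans : (R : SRel k) → R ∈qpp S → R ∈qpp S'
  ∈qpp-trans R (φ , φ-defines) = expand φ , λ t → ⇔.trans (φ-defines t) (⇔.sym (⟦expand⟧ φ t))

≡qpp-intro : {S : Vec (SRel k) s} {s' : ℕ} {S' : Vec (SRel k) s'} →
             (∀ j → lookup S j ∈qpp S') → (∀ j → lookup S' j ∈qpp S) → S ≡qpp S'
≡qpp-intro S⊆S' S'⊆S R = mk⇔ (∈qpp-trans S⊆S' R) (∈qpp-trans S'⊆S R)

map-lookup-suc : (x : X) (xs : Vec X n) (is : Vec (Fin n) j) →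
                 map (lookup (x ∷ xs)) (map suc is) ≡ map (lookup xs) is
map-lookup-suc x xs is = sym (map-∘ (lookup (x ∷ xs)) suc is)

map-lookup-↑ˡ : (xs : Vec X n) (ys : Vec X n') (is : Vec (Fin n) j) →
                map (lookup (xs ++ ys)) (map (_↑ˡ n') is) ≡ map (lookup xs) is
map-lookup-↑ˡ xs ys is = trans (sym (map-∘ _ _ is)) (map-cong (lookup-++ˡ xs ys) is)

map-lookup-↑ʳ : (xs : Vec X n) (ys : Vec X n') (is : Vec (Fin n') j) →
                map (lookup (xs ++ ys)) (map (n ↑ʳ_) is) ≡ map (lookup ys) is
map-lookup-↑ʳ xs ys is = trans (sym (map-∘ _ _ is)) (map-cong (lookup-++ʳ xs ys) is)

map-++₃ : {Y : Set} {a b c : ℕ} (f : X → Y) (xs : Vec X a) (ys : Vec X b) (zs : Vec X c) →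
          map f ((xs ++ ys) ++ zs) ≡ (map f xs ++ map f ys) ++ map f zs
map-++₃ f xs ys zs = trans (map-++ f (xs ++ ys) zs) (cong (_++ map f zs) (map-++ f xs ys))

-- Argument vectors of atoms are built from these blocks, and their lookup lemmas are stated for
-- an arbitrary element type X, so that one lemma computes both the sorts (X = Fin k) and the
-- values (X = Bool) of the arguments.
block₁ : ∀ a b c → Vec (Fin (a + b + c)) a
block₁ a b c = map (_↑ˡ c) (map (_↑ˡ b) (allFin a))

block₂ : ∀ a b c → Vec (Fin (a + b + c)) b
block₂ a b c = map (_↑ˡ c) (map (a ↑ʳ_) (allFin b))

block₃ : ∀ a b c → Vec (Fin (a + b + c)) c
block₃ a b c = map ((a + b) ↑ʳ_) (allFin c)

module _ {a b c : ℕ} (xs : Vec X a) (ys : Vec X b) (zs : Vec X c) where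
  open ≡-Reasoning

  lookup-block₁ : map (lookup ((xs ++ ys) ++ zs)) (block₁ a b c) ≡ xs
  lookup-block₁ = begin
    map (lookup ((xs ++ ys) ++ zs)) (block₁ a b c)   ≡⟨ map-lookup-↑ˡ (xs ++ ys) zs _ ⟩
    map (lookup (xs ++ ys)) (map (_↑ˡ b) (allFin a)) ≡⟨ map-lookup-↑ˡ xs ys _ ⟩
    map (lookup xs) (allFin a)                       ≡⟨ map-lookup-allFin xs ⟩
    xs                                               ∎

  lookup-block₂ : map (lookup ((xs ++ ys) ++ zs)) (block₂ a b c) ≡ ys
  lookup-block₂ = begin
    map (lookup ((xs ++ ys) ++ zs)) (block₂ a b c)   ≡⟨ map-lookup-↑ˡ (xs ++ ys) zs _ ⟩
    map (lookup (xs ++ ys)) (map (a ↑ʳ_) (allFin b)) ≡⟨ map-lookup-↑ʳ xs ys _ ⟩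
    map (lookup ys) (allFin b)                       ≡⟨ map-lookup-allFin ys ⟩
    ys                                               ∎

  lookup-block₃ : map (lookup ((xs ++ ys) ++ zs)) (block₃ a b c) ≡ zs
  lookup-block₃ = trans (map-lookup-↑ʳ (xs ++ ys) zs _) (map-lookup-allFin zs)

++-elim : ∀ a {b} (P : Vec X (a + b) → Set) → (∀ xs ys → P (xs ++ ys)) → ∀ zs → P zs
++-elim a P P-++ zs with splitAt a zs
... | xs , ys , refl = P-++ xs ys

Π-++₃-⇔ : ∀ a b c (P : Vec X (a + b + c) → Set) →
          ((t : Vec X (a + b + c)) → P t) ⇔ (∀ xs ys zs → P ((xs ++ ys) ++ zs))
Π-++₃-⇔ a b c P = mk⇔ (λ P-all xs ys zs → P-all ((xs ++ ys) ++ zs)) ++₃-elim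
  where
  ++₃-elim : (∀ xs ys zs → P ((xs ++ ys) ++ zs)) → ∀ t → P t
  ++₃-elim P-++ = ++-elim (a + b) P λ xys zs →
    ++-elim a (λ v → P (v ++ zs)) (λ xs ys → P-++ xs ys zs) xys

∨-introˡ : {x y : Bool} → T x → T (x ∨ y)
∨-introˡ = from T-∨ ∘ inj₁

∨-introʳ : {x y : Bool} → T y → T (x ∨ y)
∨-introʳ = from T-∨ ∘ inj₂

∨-map : {x x' y y' : Bool} → (T x → T x') → (T y → T y') → T (x ∨ y) → T (x' ∨ y')
∨-map f g = from T-∨ ∘ Sum.map f g ∘ to T-∨

eqB-refl : ∀ a → T (eqB a a)
eqB-refl true  = _
eqB-refl false = _

T-eqB : ∀ {a b} → T (eqB a b) → a ≡ b
T-eqB {true}  {true}  _ = refl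
T-eqB {false} {false} _ = refl

anyEq : Vec Bool n → Vec Bool n → Bool
anyEq {n} xs ys = anyF n (λ i → eqB (lookup xs i) (lookup ys i))

anyEq-map-not : (xs : Vec Bool n) → anyEq (map not xs) xs ≡ false
anyEq-map-not []           = refl
anyEq-map-not (true  ∷ xs) = anyEq-map-not xs
anyEq-map-not (false ∷ xs) = anyEq-map-not xs

anyF-cong : ∀ n {f g : Fin n → Bool} → (∀ i → f i ≡ g i) → anyF n f ≡ anyF n g
anyF-cong zero    f≗g = refl
anyF-cong (suc n) f≗g = cong₂ _∨_ (f≗g zero) (anyF-cong n (f≗g ∘ suc))

mem-disj : {m l : ℕ} (p : Vec (Fin k) m) (r : Vec (Fin k) l) (c : Vec Bool l)
           (us vs : Vec Bool m) (zs : Vec Bool l) →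
           mem (disj p r c) ((us ++ vs) ++ zs) ≡ anyEq us vs ∨ anyEq zs c
mem-disj {m = m} {l} p r c us vs zs = cong₂ _∨_
  (anyF-cong m (λ i → cong₂ eqB (trans (lookup-++ˡ (us ++ vs) zs (i ↑ˡ m)) (lookup-++ˡ us vs i))
                                (trans (lookup-++ˡ (us ++ vs) zs (m ↑ʳ i)) (lookup-++ʳ us vs i))))
  (anyF-cong l (λ h → cong (λ x → eqB x (lookup c h)) (lookup-++ʳ (us ++ vs) zs h)))

mem-disj₁ : (p r : Fin k) (c a v z : Bool) →
            mem (disj (p ∷ []) (r ∷ []) (c ∷ [])) (a ∷ v ∷ z ∷ []) ≡ eqB a v ∨ eqB z c
mem-disj₁ p r c a v z = cong₂ _∨_ (∨-identityʳ (eqB a v)) (∨-identityʳ (eqB z c))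

∨-eqB-pivot : ∀ a v D z Z →
              T ((eqB a v ∨ D) ∨ (z ∨ Z)) ⇔ Σ Bool (λ b → T ((eqB b v ∨ D) ∨ Z) × T (eqB a b ∨ z))
∨-eqB-pivot a v D z Z = mk⇔ (choose z) eliminate
  where
  choose : ∀ z → T ((eqB a v ∨ D) ∨ (z ∨ Z)) → Σ Bool (λ b → T ((eqB b v ∨ D) ∨ Z) × T (eqB a b ∨ z))
  choose true  _ = v , ∨-introˡ {y = Z} (∨-introˡ {y = D} (eqB-refl v)) , ∨-introʳ {x = eqB a v} _
  choose false q = a , q , ∨-introˡ {y = false} (eqB-refl a)

  eliminate : Σ Bool (λ b → T ((eqB b v ∨ D) ∨ Z) × T (eqB a b ∨ z)) → T ((eqB a v ∨ D) ∨ (z ∨ Z))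
  eliminate (b , q , r) with to T-∨ r
  ... | inj₁ a=b = ∨-map {x = eqB a v ∨ D} {y = Z} id (∨-introʳ {x = z})
                      (subst (λ w → T ((eqB w v ∨ D) ∨ Z)) (sym (T-eqB {a} {b} a=b)) q)
  ... | inj₂ z   = ∨-introʳ {x = eqB a v ∨ D} (∨-introˡ {y = Z} z)

pivot-tail-args : ∀ m l → Vec (Fin (suc (suc m + suc m + suc l))) (suc m + suc m + l)
pivot-tail-args m l =
  ((zero ∷ map suc (tail (block₁ (suc m) (suc m) (suc l)))) ++ map suc (block₂ (suc m) (suc m) (suc l)))
  ++ map suc (tail (block₃ (suc m) (suc m) (suc l)))

pivot-head-args : ∀ m l → Vec (Fin (suc (suc m + suc m + suc l))) 3
pivot-head-args m l =
  suc (head (block₁ (suc m) (suc m) (suc l))) ∷ zero ∷ suc (head (block₃ (suc m) (suc m) (suc l))) ∷ []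

module _ {m l : ℕ} (w u₀ : X) (us : Vec X m) (v : Vec X (suc m)) (z₀ : X) (zs : Vec X l) where
  private
    ctx : Vec X (suc m + suc m + suc l)
    ctx = ((u₀ ∷ us) ++ v) ++ (z₀ ∷ zs)

    b₁ b₂ : Vec (Fin (suc m + suc m + suc l)) (suc m)
    b₁ = block₁ (suc m) (suc m) (suc l)
    b₂ = block₂ (suc m) (suc m) (suc l)

    b₃ : Vec (Fin (suc m + suc m + suc l)) (suc l)
    b₃ = block₃ (suc m) (suc m) (suc l)

  lookup-pivot-tail-args : map (lookup (w ∷ ctx)) (pivot-tail-args m l) ≡ ((w ∷ us) ++ v) ++ zs
  lookup-pivot-tail-args =
    trans (map-++₃ (lookup (w ∷ ctx)) (zero ∷ map suc (tail b₁)) (map suc b₂) (map suc (tail b₃)))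
      (cong₂ _++_
        (cong₂ _++_ (cong (w ∷_) (trans (map-lookup-suc w ctx (tail b₁))
                                        (cong tail (lookup-block₁ (u₀ ∷ us) v (z₀ ∷ zs)))))
                    (trans (map-lookup-suc w ctx b₂) (lookup-block₂ (u₀ ∷ us) v (z₀ ∷ zs))))
        (trans (map-lookup-suc w ctx (tail b₃)) (cong tail (lookup-block₃ (u₀ ∷ us) v (z₀ ∷ zs)))))

  lookup-pivot-head-args : map (lookup (w ∷ ctx)) (pivot-head-args m l) ≡ u₀ ∷ w ∷ z₀ ∷ []
  lookup-pivot-head-args = cong₂ (λ x y → x ∷ w ∷ y ∷ [])
    (cong head (lookup-block₁ (u₀ ∷ us) v (z₀ ∷ zs))) (cong head (lookup-block₃ (u₀ ∷ us) v (z₀ ∷ zs)))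

disj-pivot-∈qpp : {m l : ℕ} (p₀ : Fin k) (ps : Vec (Fin k) m) (r₀ : Fin k) (rs : Vec (Fin k) l)
                  (c₀ : Bool) (cs : Vec Bool l) →
                  disj (p₀ ∷ ps) (r₀ ∷ rs) (c₀ ∷ cs)
                    ∈qpp (disj (p₀ ∷ ps) rs cs ∷ disj (p₀ ∷ []) (r₀ ∷ []) (c₀ ∷ []) ∷ [])
disj-pivot-∈qpp {k = k} {m} {l} p₀ ps r₀ rs c₀ cs = φ , φ-defines
  where
  P : Vec (Fin k) (suc m)
  P = p₀ ∷ ps

  Γ : Vec (Fin k) (suc (suc m + suc m + suc l))
  Γ = p₀ ∷ (P ++ P) ++ (r₀ ∷ rs)

  S : Vec (SRel k) 2
  S = disj P rs cs ∷ disj (p₀ ∷ []) (r₀ ∷ []) (c₀ ∷ []) ∷ []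

  open Formulas S
  open EquationalReasoning {k = equivalence}

  tail-sorts : map (lookup Γ) (pivot-tail-args m l) ≡ (P ++ P) ++ rs
  tail-sorts = lookup-pivot-tail-args p₀ p₀ ps P r₀ rs

  head-sorts : map (lookup Γ) (pivot-head-args m l) ≡ p₀ ∷ p₀ ∷ r₀ ∷ []
  head-sorts = lookup-pivot-head-args p₀ p₀ ps P r₀ rs

  tail-atom head-atom : Fm S Γ
  tail-atom = atomᵛ zero (pivot-tail-args m l) tail-sorts
  head-atom = atomᵛ (suc zero) (pivot-head-args m l) head-sorts

  ⟦tail-atom⟧ : ∀ b a us v vs z zs →
                ⟦ tail-atom ⟧ (b ∷ ((a ∷ us) ++ (v ∷ vs)) ++ (z ∷ zs)) ≡ T ((eqB b v ∨ anyEq us vs) ∨ anyEq zs cs)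
  ⟦tail-atom⟧ b a us v vs z zs =
    trans (⟦atomᵛ⟧ {Γ = Γ} zero (pivot-tail-args m l) tail-sorts
                   (b ∷ ((a ∷ us) ++ (v ∷ vs)) ++ (z ∷ zs))
                   (lookup-pivot-tail-args b a us (v ∷ vs) z zs))
          (cong T (mem-disj P rs cs (b ∷ us) (v ∷ vs) zs))

  ⟦head-atom⟧ : ∀ b a us v vs z zs →
                ⟦ head-atom ⟧ (b ∷ ((a ∷ us) ++ (v ∷ vs)) ++ (z ∷ zs)) ≡ T (eqB a b ∨ eqB z c₀)
  ⟦head-atom⟧ b a us v vs z zs =
    trans (⟦atomᵛ⟧ {Γ = Γ} (suc zero) (pivot-head-args m l) head-sorts
                   (b ∷ ((a ∷ us) ++ (v ∷ vs)) ++ (z ∷ zs))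
                   (lookup-pivot-head-args b a us (v ∷ vs) z zs))
          (cong T (mem-disj₁ p₀ r₀ c₀ a b z))

  φ : Fm S ((P ++ P) ++ (r₀ ∷ rs))
  φ = ex p₀ (and tail-atom head-atom)

  φ-defines : ∀ t → T (mem (disj P (r₀ ∷ rs) (c₀ ∷ cs)) t) ⇔ ⟦ φ ⟧ t
  φ-defines = from (Π-++₃-⇔ (suc m) (suc m) (suc l) _) λ where
    (a ∷ us) (v ∷ vs) (z ∷ zs) → begin
      T (mem (disj P (r₀ ∷ rs) (c₀ ∷ cs)) (((a ∷ us) ++ (v ∷ vs)) ++ (z ∷ zs)))
        ≡⟨ cong T (mem-disj P (r₀ ∷ rs) (c₀ ∷ cs) (a ∷ us) (v ∷ vs) (z ∷ zs)) ⟩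
      T ((eqB a v ∨ anyEq us vs) ∨ (eqB z c₀ ∨ anyEq zs cs))
        ∼⟨ ∨-eqB-pivot a v (anyEq us vs) (eqB z c₀) (anyEq zs cs) ⟩
      Σ Bool (λ b → T ((eqB b v ∨ anyEq us vs) ∨ anyEq zs cs) × T (eqB a b ∨ eqB z c₀))
        ∼⟨ Σ-cong-⇔ (λ b → ⇔-reflexive (sym (⟦tail-atom⟧ b a us v vs z zs))
                       ×-⇔ ⇔-reflexive (sym (⟦head-atom⟧ b a us v vs z zs))) ⟩
      ⟦ φ ⟧ (((a ∷ us) ++ (v ∷ vs)) ++ (z ∷ zs)) ∎

∀-eqB-∨ : ∀ D c Z → T (D ∨ Z) ⇔ ((b : Bool) → T (D ∨ (eqB b c ∨ Z)))
∀-eqB-∨ D c Z = mk⇔ (λ q b → ∨-map {x = D} {y = Z} id (∨-introʳ {x = eqB b c}) q) (λ q → at-not c (q (not c)))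
  where
  at-not : ∀ c → T (D ∨ (eqB (not c) c ∨ Z)) → T (D ∨ Z)
  at-not true  q = q
  at-not false q = q

∀const-args : ∀ m l → Vec (Fin (suc (m + m + l))) (m + m + suc l)
∀const-args m l = (map suc (block₁ m m l) ++ map suc (block₂ m m l)) ++ (zero ∷ map suc (block₃ m m l))

lookup-∀const-args : {m l : ℕ} (w : X) (u v : Vec X m) (z : Vec X l) →
                     map (lookup (w ∷ (u ++ v) ++ z)) (∀const-args m l) ≡ (u ++ v) ++ (w ∷ z)
lookup-∀const-args {X = X} {m = m} {l} w u v z =
  trans (map-++₃ (lookup (w ∷ ctx)) (map suc b₁) (map suc b₂) (zero ∷ map suc b₃))
    (cong₂ _++_ (cong₂ _++_ (trans (map-lookup-suc w ctx b₁) (lookup-block₁ u v z))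
                            (trans (map-lookup-suc w ctx b₂) (lookup-block₂ u v z)))
                (cong (w ∷_) (trans (map-lookup-suc w ctx b₃) (lookup-block₃ u v z))))
  where
  ctx : Vec X (m + m + l)
  ctx = (u ++ v) ++ z
  b₁ b₂ : Vec (Fin (m + m + l)) m
  b₁ = block₁ m m l
  b₂ = block₂ m m l
  b₃ : Vec (Fin (m + m + l)) l
  b₃ = block₃ m m l

disj-∀const-∈qpp : {m l : ℕ} (p : Vec (Fin k) m) (r₀ : Fin k) (r : Vec (Fin k) l) (c₀ : Bool) (c : Vec Bool l) →
                   disj p r c ∈qpp (disj p (r₀ ∷ r) (c₀ ∷ c) ∷ [])
disj-∀const-∈qpp {k = k} {m} {l} p r₀ r c₀ c = φ , φ-defines
  where
  Γ : Vec (Fin k) (suc (m + m + l))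
  Γ = r₀ ∷ (p ++ p) ++ r

  S : Vec (SRel k) 1
  S = disj p (r₀ ∷ r) (c₀ ∷ c) ∷ []

  open Formulas S
  open EquationalReasoning {k = equivalence}

  R-sorts : map (lookup Γ) (∀const-args m l) ≡ (p ++ p) ++ (r₀ ∷ r)
  R-sorts = lookup-∀const-args r₀ p p r

  R-atom : Fm S Γ
  R-atom = atomᵛ zero (∀const-args m l) R-sorts

  ⟦R-atom⟧ : ∀ b u v z → ⟦ R-atom ⟧ (b ∷ (u ++ v) ++ z) ≡ T (anyEq u v ∨ (eqB b c₀ ∨ anyEq z c))
  ⟦R-atom⟧ b u v z =
    trans (⟦atomᵛ⟧ {Γ = Γ} zero (∀const-args m l) R-sorts (b ∷ (u ++ v) ++ z) (lookup-∀const-args b u v z))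
          (cong T (mem-disj p (r₀ ∷ r) (c₀ ∷ c) u v (b ∷ z)))

  φ : Fm S ((p ++ p) ++ r)
  φ = all r₀ R-atom

  φ-defines : ∀ t → T (mem (disj p r c) t) ⇔ ⟦ φ ⟧ t
  φ-defines = from (Π-++₃-⇔ m m l _) λ u v z → begin
    T (mem (disj p r c) ((u ++ v) ++ z))
      ≡⟨ cong T (mem-disj p r c u v z) ⟩
    T (anyEq u v ∨ anyEq z c)
      ∼⟨ ∀-eqB-∨ (anyEq u v) c₀ (anyEq z c) ⟩
    ((b : Bool) → T (anyEq u v ∨ (eqB b c₀ ∨ anyEq z c)))
      ∼⟨ Π-cong-⇔ (λ b → ⇔-reflexive (sym (⟦R-atom⟧ b u v z))) ⟩
    ⟦ φ ⟧ ((u ++ v) ++ z) ∎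

∀-anyEq-∨ : {m l : ℕ} (x y : Bool) (c : Vec Bool l) →
            T (x ∨ y) ⇔ ((u v : Vec Bool m) (z : Vec Bool l) → T ((x ∨ anyEq u v) ∨ (y ∨ anyEq z c)))
∀-anyEq-∨ {m = m} x y c = mk⇔
  (λ q u v z → ∨-map {x = x} {y = y} (∨-introˡ {y = anyEq u v}) (∨-introˡ {y = anyEq z c}) q)
  (λ q → subst T (cong₂ _∨_ (falsified x (replicate m true)) (falsified y c))
                 (q (map not (replicate m true)) (replicate m true) (map not c)))
  where
  falsified : {n : ℕ} (x : Bool) (xs : Vec Bool n) → x ∨ anyEq (map not xs) xs ≡ x
  falsified x xs = trans (cong (x ∨_) (anyEq-map-not xs)) (∨-identityʳ x)

∀rest-args : ∀ m l → Vec (Fin (m + m + l + 3)) (suc m + suc m + suc l)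
∀rest-args m l =
  (((N ↑ʳ zero) ∷ map (_↑ˡ 3) (block₁ m m l)) ++ ((N ↑ʳ suc zero) ∷ map (_↑ˡ 3) (block₂ m m l)))
  ++ ((N ↑ʳ suc (suc zero)) ∷ map (_↑ˡ 3) (block₃ m m l))
  where
  N : ℕ
  N = m + m + l

lookup-∀rest-args : {m l : ℕ} (u v : Vec X m) (z : Vec X l) (a b c : X) →
                    map (lookup (((u ++ v) ++ z) ++ (a ∷ b ∷ c ∷ []))) (∀rest-args m l)
                      ≡ ((a ∷ u) ++ (b ∷ v)) ++ (c ∷ z)
lookup-∀rest-args {X = X} {m = m} {l} u v z a b c =
  trans (map-++₃ (lookup (d ++ e)) (cons-var zero b₁) (cons-var (suc zero) b₂) (cons-var (suc (suc zero)) b₃))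
    (cong₂ _++_ (cong₂ _++_ (lookup-cons-var zero b₁ (lookup-block₁ u v z))
                            (lookup-cons-var (suc zero) b₂ (lookup-block₂ u v z)))
                (lookup-cons-var (suc (suc zero)) b₃ (lookup-block₃ u v z)))
  where
  d : Vec X (m + m + l)
  d = (u ++ v) ++ z
  e : Vec X 3
  e = a ∷ b ∷ c ∷ []
  b₁ b₂ : Vec (Fin (m + m + l)) m
  b₁ = block₁ m m l
  b₂ = block₂ m m l
  b₃ : Vec (Fin (m + m + l)) l
  b₃ = block₃ m m l
  cons-var : ∀ {j} → Fin 3 → Vec (Fin (m + m + l)) j → Vec (Fin (m + m + l + 3)) (suc j)
  cons-var i is = ((m + m + l) ↑ʳ i) ∷ map (_↑ˡ 3) is
  lookup-cons-var : ∀ {j} (i : Fin 3) (is : Vec (Fin (m + m + l)) j) {xs : Vec X j} → map (lookup d) is ≡ xs →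
                    map (lookup (d ++ e)) (cons-var i is) ≡ lookup e i ∷ xs
  lookup-cons-var i is is-values = cong₂ _∷_ (lookup-++ʳ d e i) (trans (map-lookup-↑ˡ d e is) is-values)

disj-∀rest-∈qpp : {m l : ℕ} (p₀ : Fin k) (ps : Vec (Fin k) m) (r₀ : Fin k) (rs : Vec (Fin k) l)
                  (c₀ : Bool) (cs : Vec Bool l) →
                  disj (p₀ ∷ []) (r₀ ∷ []) (c₀ ∷ []) ∈qpp (disj (p₀ ∷ ps) (r₀ ∷ rs) (c₀ ∷ cs) ∷ [])
disj-∀rest-∈qpp {k = k} {m} {l} p₀ ps r₀ rs c₀ cs = φ , φ-defines
  where
  Δ : Vec (Fin k) (m + m + l)
  Δ = (ps ++ ps) ++ rs

  Γ : Vec (Fin k) (m + m + l + 3)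
  Γ = Δ ++ (p₀ ∷ p₀ ∷ r₀ ∷ [])

  S : Vec (SRel k) 1
  S = disj (p₀ ∷ ps) (r₀ ∷ rs) (c₀ ∷ cs) ∷ []

  open Formulas S
  open EquationalReasoning {k = equivalence}

  R-sorts : map (lookup Γ) (∀rest-args m l) ≡ ((p₀ ∷ ps) ++ (p₀ ∷ ps)) ++ (r₀ ∷ rs)
  R-sorts = lookup-∀rest-args ps ps rs p₀ p₀ r₀

  R-atom : Fm S Γ
  R-atom = atomᵛ zero (∀rest-args m l) R-sorts

  ⟦R-atom⟧ : ∀ du dv dz a v z →
             ⟦ R-atom ⟧ (((du ++ dv) ++ dz) ++ (a ∷ v ∷ z ∷ []))
               ≡ T ((eqB a v ∨ anyEq du dv) ∨ (eqB z c₀ ∨ anyEq dz cs))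
  ⟦R-atom⟧ du dv dz a v z =
    trans (⟦atomᵛ⟧ {Γ = Γ} zero (∀rest-args m l) R-sorts (((du ++ dv) ++ dz) ++ (a ∷ v ∷ z ∷ []))
                   (lookup-∀rest-args du dv dz a v z))
          (cong T (mem-disj (p₀ ∷ ps) (r₀ ∷ rs) (c₀ ∷ cs) (a ∷ du) (v ∷ dv) (z ∷ dz)))

  φ : Fm S (p₀ ∷ p₀ ∷ r₀ ∷ [])
  φ = ∀ⁿ Δ R-atom

  φ-defines : ∀ t → T (mem (disj (p₀ ∷ []) (r₀ ∷ []) (c₀ ∷ [])) t) ⇔ ⟦ φ ⟧ t
  φ-defines t@(a ∷ v ∷ z ∷ []) = begin
    T (mem (disj (p₀ ∷ []) (r₀ ∷ []) (c₀ ∷ [])) t)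
      ≡⟨ cong T (mem-disj₁ p₀ r₀ c₀ a v z) ⟩
    T (eqB a v ∨ eqB z c₀)
      ∼⟨ ∀-anyEq-∨ (eqB a v) (eqB z c₀) cs ⟩
    ((du dv : Vec Bool m) (dz : Vec Bool l) → T ((eqB a v ∨ anyEq du dv) ∨ (eqB z c₀ ∨ anyEq dz cs)))
      ∼⟨ Π-cong-⇔ (λ du → Π-cong-⇔ λ dv → Π-cong-⇔ λ dz → ⇔-reflexive (sym (⟦R-atom⟧ du dv dz a v z))) ⟩
    ((du dv : Vec Bool m) (dz : Vec Bool l) → ⟦ R-atom ⟧ (((du ++ dv) ++ dz) ++ t))
      ∼⟨ ⇔.sym (Π-++₃-⇔ m m l (λ d → ⟦ R-atom ⟧ (d ++ t))) ⟩
    ((d : Vec Bool (m + m + l)) → ⟦ R-atom ⟧ (d ++ t))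
      ∼⟨ ⇔.sym (⟦∀ⁿ⟧ Δ R-atom t) ⟩
    ⟦ φ ⟧ t ∎

lemma3p7 : (k m l : ℕ) (p : Vec (Fin k) (suc m)) (r : Vec (Fin k) (suc l)) (c : Vec Bool (suc l)) →
    (disj p r c ∷ []) ≡qpp (disj p (tail r) (tail c) ∷ disj (head p ∷ []) (head r ∷ []) (head c ∷ []) ∷ [])
lemma3p7 k m l p@(p₀ ∷ ps) (r₀ ∷ rs) (c₀ ∷ cs) = ≡qpp-intro whole-definable parts-definable
  where
  whole-definable : ∀ j → lookup (disj p (r₀ ∷ rs) (c₀ ∷ cs) ∷ []) j
                          ∈qpp (disj p rs cs ∷ disj (p₀ ∷ []) (r₀ ∷ []) (c₀ ∷ []) ∷ [])
  whole-definable zero = disj-pivot-∈qpp p₀ ps r₀ rs c₀ cs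

  parts-definable : ∀ j → lookup (disj p rs cs ∷ disj (p₀ ∷ []) (r₀ ∷ []) (c₀ ∷ []) ∷ []) j
                          ∈qpp (disj p (r₀ ∷ rs) (c₀ ∷ cs) ∷ [])
  parts-definable zero       = disj-∀const-∈qpp p r₀ rs c₀ cs
  parts-definable (suc zero) = disj-∀rest-∈qpp p₀ ps r₀ rs c₀ cs
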